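{- For all $n\ge 4$, the girth of the graph $G(3,n)$ is $4$.
   Context: For a prime $p$ and $n\in\mathbb{N}$, $G(p,n)$ is the simple graph with vertex set $\{2,4,\ldots,2n\}$ in which two distinct vertices $a,b$ are adjacent if and only if both $\frac{a+b}{2}$ and $\frac{|a-b|}{2}$ are odd positive integers neither of which equals $pk$ for an integer $k\ge 2$. The girth is the length of a shortest cycle. -}

module Defs where

open import Data.Nat using (ℕ; zero; suc; _+_; _*_; _∸_; _≤_; _<_; ∣_-_∣)
open import Data.Product using (Σ; ∃; _×_)
open import Relation.Nullary using (¬_)
open import Relation.Binary.PropositionalEquality using (_≡_; _≢_)

Odd : ℕ → Set
Odd m = ∃ λ j → m ≡ 2 * j + 1

MultGe2 : ℕ → ℕ → Set
MultGe2 p m = ∃ λ k → 2 ≤ k × m ≡ p * k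

Good : ℕ → ℕ → Set
Good p m = 0 < m × Odd m × ¬ MultGe2 p m

IsVertex : ℕ → ℕ → Set
IsVertex n a = ∃ λ i → 1 ≤ i × i ≤ n × a ≡ 2 * i

Adj : ℕ → ℕ → ℕ → ℕ → Set
Adj p n a b =
  IsVertex n a × IsVertex n b × a ≢ b ×
  (∃ λ s → a + b ≡ 2 * s × Good p s) ×
  (∃ λ d → ∣ a - b ∣ ≡ 2 * d × Good p d)

record Cycle (E : ℕ → ℕ → Set) (k : ℕ) : Set where
  field
    len≥3    : 3 ≤ k
    v        : ℕ → ℕ
    distinct : ∀ i j → i < k → j < k → v i ≡ v j → i ≡ j
    step     : ∀ i → suc i < k → E (v i) (v (suc i))
    close    : E (v (k ∸ 1)) (v 0)

IsGirth : (ℕ → ℕ → Set) → ℕ → Set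
IsGirth E g = Cycle E g × (∀ k → Cycle E k → g ≤ k)

G : ℕ → ℕ → ℕ → ℕ → Set
G p n = Adj p n

{-# OPTIONS --safe #-}
-- Every edge sum a + b is twice an odd number, i.e. 2 mod 4; around a triangle the three edge
-- sums add up to 2 (a + b + c), which would make the sum of three even vertices odd.  So there are
-- no triangles, and 2 - 4 - 6 - 8 - 2 is a 4-cycle whose half-sums and half-differences
-- 3, 5, 7, 5 and 1, 1, 1, 3 are all odd and too small to be proper multiples of p ≥ 3.
module Submission where

open import Defs
open import Data.Nat using (ℕ; _≤_; suc; _+_; _*_; _<_; ∣_-_∣; z≤n; s≤s; s≤s⁻¹)
open import Data.Nat.Properties
open import Data.Nat.Tactic.RingSolver using (solve-∀)
open import Data.Fin using (Fin; toℕ; #_)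
open import Data.Fin.Properties using (toℕ<n)
open import Data.Product using (∃; _,_)
open import Data.Sum using (inj₁; inj₂)
open import Data.Empty using (⊥; ⊥-elim)
open import Relation.Nullary using (¬_)
open import Relation.Binary.PropositionalEquality

adjacent-sum : ∀ {p n a b} → G p n a b → ∃ λ j → a + b ≡ 2 * (2 * j + 1)
adjacent-sum (_ , _ , _ , (_ , a+b≡2s , _ , (j , s≡2j+1) , _) , _) =
  j , trans a+b≡2s (cong (2 *_) s≡2j+1)

no-triangle-sums : ∀ x y z i j k →
                   2 * x + 2 * y ≡ 2 * (2 * i + 1) →
                   2 * y + 2 * z ≡ 2 * (2 * j + 1) →
                   2 * z + 2 * x ≡ 2 * (2 * k + 1) → ⊥
no-triangle-sums x y z i j k xy yz zx =
  even≢odd (x + y + z) (i + j + k + 1) (*-cancelˡ-≡ _ _ 2 (begin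
    2 * (2 * (x + y + z))                               ≡⟨ regroup-vertices x y z ⟩
    (2 * x + 2 * y) + (2 * y + 2 * z) + (2 * z + 2 * x) ≡⟨ cong₂ _+_ (cong₂ _+_ xy yz) zx ⟩
    2 * (2 * i + 1) + 2 * (2 * j + 1) + 2 * (2 * k + 1) ≡⟨ regroup-sums i j k ⟩
    2 * suc (2 * (i + j + k + 1))                       ∎))
  where
  open ≡-Reasoning
  regroup-vertices : ∀ x y z →
    2 * (2 * (x + y + z)) ≡ (2 * x + 2 * y) + (2 * y + 2 * z) + (2 * z + 2 * x)
  regroup-vertices = solve-∀
  regroup-sums : ∀ i j k →
    2 * (2 * i + 1) + 2 * (2 * j + 1) + 2 * (2 * k + 1) ≡ 2 * suc (2 * (i + j + k + 1))
  regroup-sums = solve-∀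

no-triangle-edges : ∀ {p n a b c} → G p n a b → G p n b c → G p n c a → ⊥
no-triangle-edges {p} ab@((x , _ , _ , refl) , (y , _ , _ , refl) , _)
                      bc@(_ , (z , _ , _ , refl) , _) ca
  with (i , xy) ← adjacent-sum {p} ab
     | (j , yz) ← adjacent-sum {p} bc
     | (k , zx) ← adjacent-sum {p} ca
  = no-triangle-sums x y z i j k xy yz zx

no-triangle : ∀ {p n} → ¬ Cycle (G p n) 3
no-triangle {p} C = no-triangle-edges {p} (step 0 (s≤s (s≤s z≤n))) (step 1 ≤-refl) close
  where open Cycle C

cycle-length≥4 : ∀ {p n k} → Cycle (G p n) k → 4 ≤ k
cycle-length≥4 {p} C with m≤n⇒m<n∨m≡n (Cycle.len≥3 C)
... | inj₁ 3<k  = 3<k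
... | inj₂ refl = ⊥-elim (no-triangle {p} C)

odd⇒¬MultGe2 : ∀ {p m} → Odd m → m < 3 * p → ¬ MultGe2 p m
odd⇒¬MultGe2 _ _ (0 , () , _)
odd⇒¬MultGe2 _ _ (1 , s≤s () , _)
odd⇒¬MultGe2 {p} (j , refl) _ (2 , _ , 2j+1≡p*2) =
  even≢odd p j (trans (*-comm 2 p) (trans (sym 2j+1≡p*2) (+-comm (2 * j) 1)))
odd⇒¬MultGe2 {p} {m} _ m<3p (suc (suc (suc k)) , _ , m≡p*[3+k]) = <⇒≱ m<3p (begin
  3 * p           ≡⟨ *-comm 3 p ⟩
  p * 3           ≤⟨ *-monoʳ-≤ p (m≤m+n 3 k) ⟩
  p * (3 + k)     ≡⟨ sym m≡p*[3+k] ⟩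
  m               ∎)
  where open ≤-Reasoning

odd⇒Good : ∀ {p m} → Odd m → m < 3 * p → Good p m
odd⇒Good {p} m-odd@(j , refl) m<3p = m≤n+m 1 (2 * j) , m-odd , odd⇒¬MultGe2 {p} m-odd m<3p

module Square {p n : ℕ} (3≤p : 3 ≤ p) (4≤n : 4 ≤ n) where

  corner : ℕ → ℕ
  corner i = 2 * suc i

  corner-vertex : (i : Fin 4) → IsVertex n (corner (toℕ i))
  corner-vertex i = suc (toℕ i) , s≤s z≤n , ≤-trans (toℕ<n i) 4≤n , refl

  Good-2j+1 : (j : Fin 4) → Good p (2 * toℕ j + 1)
  Good-2j+1 j = odd⇒Good {p} (toℕ j , refl)
    -- 2 j + 1 ≤ 7 < 9 ≤ 3 p
    (<-≤-trans (s≤s (m≤n⇒m≤1+n (+-monoˡ-≤ 1 (*-monoʳ-≤ 2 (s≤s⁻¹ (toℕ<n j))))))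
               (*-monoʳ-≤ 3 3≤p))

  corner-edge : (i k s d : Fin 4) → let a = corner (toℕ i); b = corner (toℕ k) in
                a ≢ b → a + b ≡ 2 * (2 * toℕ s + 1) → ∣ a - b ∣ ≡ 2 * (2 * toℕ d + 1) →
                G p n a b
  corner-edge i k s d a≢b a+b≡2s ∣a-b∣≡2d =
    corner-vertex i , corner-vertex k , a≢b ,
    (_ , a+b≡2s , Good-2j+1 s) , (_ , ∣a-b∣≡2d , Good-2j+1 d)

  square : Cycle (G p n) 4
  square = record
    { len≥3    = s≤s (s≤s (s≤s z≤n))
    ; v        = corner
    ; distinct = λ i j _ _ eq → suc-injective (*-cancelˡ-≡ (suc i) (suc j) 2 eq)
    ; step     = step
    ; close    = corner-edge (# 3) (# 0) (# 2) (# 1) (λ ()) refl refl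
    }
    where
    step : ∀ i → suc i < 4 → G p n (corner i) (corner (suc i))
    step 0 _ = corner-edge (# 0) (# 1) (# 1) (# 0) (λ ()) refl refl
    step 1 _ = corner-edge (# 1) (# 2) (# 2) (# 0) (λ ()) refl refl
    step 2 _ = corner-edge (# 2) (# 3) (# 3) (# 0) (λ ()) refl refl
    step (suc (suc (suc _))) (s≤s (s≤s (s≤s (s≤s ()))))

girth≡4 : ∀ {p n} → 3 ≤ p → 4 ≤ n → IsGirth (G p n) 4
girth≡4 {p} 3≤p 4≤n = Square.square 3≤p 4≤n , λ _ → cycle-length≥4 {p}

proposition4p2 : ∀ (n : ℕ) → 4 ≤ n → IsGirth (G 3 n) 4
proposition4p2 n = girth≡4 ≤-refl
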